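{- Let $X$ be an orientable map of type $(k,d)$ with incidence multiplicity $\alpha$. Then every diagonal entry of $U$ equals \[ \frac{4\alpha}{kd}-\frac{2}{k}-\frac{2}{d}+1, \] and \[ \operatorname{tr}(U)=\frac{4\alpha|V|}{k}-2|F|-2|V|+|\mathcal A|. \]
   Context: An orientable map $X$ is a 2-cell embedding of a finite connected multigraph (loops and parallel edges allowed) in a closed orientable surface, with vertex set $V$ and face set $F$. Each edge gives two arcs on opposite sides of it, pointing in opposite directions, each lying in a face and oriented along its clockwise facial walk. Let $\mathcal A$ be the arc set, $v(a)$ the tail vertex and $f(a)$ the face of arc $a$; $N\in\{0,1\}^{\mathcal A\times V}$ with $N(a,w)=1$ iff $w=v(a)$; $M\in\{0,1\}^{\mathcal A\times F}$ with $M(a,f)=1$ iff $f=f(a)$; $D=N^TN$, $\Delta=M^TM$ (vertex and face degrees); $\hat N=ND^{ -1/2}$, $\hat M=M\Delta^{ -1/2}$, $Q=\hat N\hat N^T$, $P=\hat M\hat M^T$; $U=(2P-I)(2Q-I)$. $X$ is of type $(k,d)$ if every vertex has degree $d$ and every face has degree $k$. $X$ has incidence multiplicity $\alpha$ if whenever a vertex appears on the facial walk of a face, it appears there exactly $\alpha$ times (all nonzero entries of $N^TM$ equal $\alpha$). -}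

module Defs where

open import Data.Nat as ℕ using (ℕ; zero; suc)
open import Data.Integer as ℤ using ()
open import Data.Fin using (Fin; zero; suc; _≟_)
open import Data.Fin.Permutation using (Permutation′; _⟨$⟩ʳ_)
open import Data.Rational as ℚ using (ℚ; 0ℚ; 1ℚ; _+_; _-_; _*_; _/_; 1/_; ≢-nonZero)
open import Data.Rational.Properties as ℚP using ()
open import Data.Product using (Σ; ∃; _×_; _,_)
open import Relation.Binary.PropositionalEquality using (_≡_; _≢_)
open import Relation.Nullary using (yes; no; ¬_)
open import Function.Bundles using (_⇔_)

-- Combinatorial (rotation-system) description of an orientable map.
-- Arcs (= darts, one on each side of each edge) are Fin nA.
-- σ  : rotation of arcs around their tail vertex,
-- θ  : the fixed-point-free involution sending an arc to the other arc
--      of the same edge,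
-- φ = σ ∘ θ : successor of an arc along its (clockwise) facial walk.
-- Vertices are the σ-orbits and faces the φ-orbits; we carry explicit
-- finite index sets Fin nV, Fin nF with the tail map vert and the face
-- map face, required to identify exactly these orbits.

iter : ∀ {n} → (Fin n → Fin n) → ℕ → Fin n → Fin n
iter g zero    x = x
iter g (suc m) x = g (iter g m x)

-- b lies in the forward orbit of a under g (for permutations of a finite
-- set this is the orbit relation)
SameOrbit : ∀ {n} → (Fin n → Fin n) → Fin n → Fin n → Set
SameOrbit g a b = ∃ λ m → iter g m a ≡ b

data Reach {n : ℕ} (σ θ : Fin n → Fin n) : Fin n → Fin n → Set where
  here  : ∀ {a} → Reach σ θ a a
  stepσ : ∀ {a b} → Reach σ θ (σ a) b → Reach σ θ a b
  stepθ : ∀ {a b} → Reach σ θ (θ a) b → Reach σ θ a b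

record OrientableMap : Set where
  field
    nA nV nF : ℕ
    σ θ      : Permutation′ nA
    vert     : Fin nA → Fin nV
    face     : Fin nA → Fin nF

    θ-invol     : ∀ a → θ ⟨$⟩ʳ (θ ⟨$⟩ʳ a) ≡ a
    θ-fpf       : ∀ a → θ ⟨$⟩ʳ a ≢ a
    connected   : ∀ a b → Reach (σ ⟨$⟩ʳ_) (θ ⟨$⟩ʳ_) a b
    vert-surj   : ∀ w → ∃ λ a → vert a ≡ w
    face-surj   : ∀ f → ∃ λ a → face a ≡ f
    vert-orbits : ∀ a b → (vert a ≡ vert b) ⇔ SameOrbit (σ ⟨$⟩ʳ_) a b
    face-orbits : ∀ a b → (face a ≡ face b) ⇔ SameOrbit (λ x → σ ⟨$⟩ʳ (θ ⟨$⟩ʳ x)) a b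

Σℚ : ∀ n → (Fin n → ℚ) → ℚ
Σℚ zero    f = 0ℚ
Σℚ (suc n) f = f zero + Σℚ n (λ i → f (suc i))

Mat : ℕ → ℕ → Set
Mat m n = Fin m → Fin n → ℚ

_⊗_ : ∀ {m n p} → Mat m n → Mat n p → Mat m p
_⊗_ {n = n} A B i j = Σℚ n (λ k → A i k * B k j)

infixl 7 _⊗_

_ᵀ : ∀ {m n} → Mat m n → Mat n m
(A ᵀ) i j = A j i

δ : ∀ {n} → Fin n → Fin n → ℚ
δ i j with i ≟ j
... | yes _ = 1ℚ
... | no  _ = 0ℚ

I : ∀ {n} → Mat n n
I = δ

_⊖_ : ∀ {m n} → Mat m n → Mat m n → Mat m n
(A ⊖ B) i j = A i j - B i j

scale : ∀ {m n} → ℚ → Mat m n → Mat m n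
scale c A i j = c * A i j

tr : ∀ {n} → Mat n n → ℚ
tr {n} A = Σℚ n (λ i → A i i)

-- inverse of a rational (only ever applied to nonzero degrees below)
invℚ : ℚ → ℚ
invℚ p with p ℚP.≟ 0ℚ
... | yes _  = 0ℚ
... | no p≢0 = 1/_ p {{≢-nonZero p≢0}}

diagInv : ∀ {n} → Mat n n → Mat n n
diagInv A i j = δ i j * invℚ (A i i)

2ℚ : ℚ
2ℚ = 1ℚ + 1ℚ

module MapMatrices (X : OrientableMap) where
  open OrientableMap X

  𝟙 : ∀ {n} → Fin n → Fin n → ℚ
  𝟙 = δ

  N : Mat nA nV
  N a w = 𝟙 (vert a) w

  M : Mat nA nF
  M a f = 𝟙 (face a) f

  D : Mat nV nV
  D = N ᵀ ⊗ N

  Δ : Mat nF nF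
  Δ = M ᵀ ⊗ M

  -- Q = N̂ N̂ᵀ = N D^{-1/2} D^{-1/2} Nᵀ = N D^{-1} Nᵀ
  Q : Mat nA nA
  Q = N ⊗ diagInv D ⊗ N ᵀ

  -- P = M̂ M̂ᵀ = M Δ^{-1} Mᵀ
  P : Mat nA nA
  P = M ⊗ diagInv Δ ⊗ M ᵀ

  U : Mat nA nA
  U = (scale 2ℚ P ⊖ I) ⊗ (scale 2ℚ Q ⊖ I)

  -- number of occurrences of vertex w on the facial walk of face f
  NᵀM : Mat nV nF
  NᵀM = N ᵀ ⊗ M

ℕ→ℚ : ℕ → ℚ
ℕ→ℚ n = ℤ.+ n / 1

-- type (k,d): every vertex has degree d and every face has degree k,
-- degrees being the diagonal entries of D = NᵀN and Δ = MᵀM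
IsOfType : OrientableMap → ℕ → ℕ → Set
IsOfType X k d = (∀ w → D w w ≡ ℕ→ℚ d) × (∀ f → Δ f f ≡ ℕ→ℚ k)
  where open MapMatrices X

HasIncidenceMultiplicity : OrientableMap → ℕ → Set
HasIncidenceMultiplicity X α = ∀ w f → NᵀM w f ≢ 0ℚ → NᵀM w f ≡ ℕ→ℚ α
  where open MapMatrices X

{-# OPTIONS --safe #-}
-- Since every face has degree k and every vertex degree d, the projections P and Q are
-- block averaging operators: P a b = [face a = face b]/k and Q a b = [vert a = vert b]/d.
-- Expanding U = 4PQ − 2P − 2Q + I, the only nonconstant part of U a a is
-- (PQ) a a = #{b : vert b = vert a, face b = face a}/(kd), and this count is α because it
-- includes b = a. Summing over the arcs and using |A| = d|V| = k|F| gives the trace.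
module Submission where

open import Defs
open import Data.Nat as ℕ using (ℕ; zero; suc; NonZero)
open import Data.Nat.Properties as ℕP using (m*n≢0)
open import Data.Integer as ℤ using ()
import Data.Integer.Properties as ℤP
open import Data.Fin using (Fin; zero; suc; _≟_)
open import Data.Rational using (ℚ; 0ℚ; 1ℚ; _+_; _-_; _*_; _/_; 1/_; _≤_; _<_; toℚᵘ; ≢-nonZero)
import Data.Rational.Properties as QP
open import Data.Rational.Unnormalised as ℚᵘ using (mkℚᵘ) renaming (_≃_ to _≃ᵘ_)
import Data.Rational.Unnormalised.Properties as ℚᵘP
open import Data.Product using (_×_; _,_; proj₁; proj₂)
open import Algebra.Bundles using (Semiring; CommutativeRing)
open import Function using (_∘_)
open import Relation.Nullary using (yes; no)
open import Relation.Nullary.Negation using (contradiction)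
open import Relation.Nullary.Decidable using (dec⇒maybe)
open import Relation.Binary.PropositionalEquality
open import Tactic.RingSolver using (solve-∀)
open import Tactic.RingSolver.Core.AlmostCommutativeRing using (AlmostCommutativeRing; fromCommutativeRing)

ℚ-semiring : Semiring _ _
ℚ-semiring = CommutativeRing.semiring QP.+-*-commutativeRing

open import Algebra.Properties.Semiring.Mult ℚ-semiring using (×1-homo-*; ×-assoc-*)
  renaming (_×_ to _·_)
open import Algebra.Properties.Semiring.Sum ℚ-semiring
  using (sum; sum-cong-≗; sum-replicate; ∑-distrib-+; ∑-comm; *-distribˡ-sum)

ℚ-ring : AlmostCommutativeRing _ _
ℚ-ring = fromCommutativeRing QP.+-*-commutativeRing (λ p → dec⇒maybe (0ℚ QP.≟ p))

toℚᵘ-ℕ→ℚ : ∀ n → toℚᵘ (ℕ→ℚ n) ≃ᵘ mkℚᵘ (ℤ.+ n) 0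
toℚᵘ-ℕ→ℚ n = QP.toℚᵘ-fromℚᵘ (mkℚᵘ (ℤ.+ n) 0)

ℕ→ℚ-suc : ∀ n → ℕ→ℚ (suc n) ≡ 1ℚ + ℕ→ℚ n
ℕ→ℚ-suc n = QP.toℚᵘ-injective (begin
  toℚᵘ (ℕ→ℚ (suc n))                     ≈⟨ toℚᵘ-ℕ→ℚ (suc n) ⟩
  mkℚᵘ (ℤ.+ suc n) 0                     ≡⟨ cong (λ z → mkℚᵘ (ℤ.+ 1 ℤ.+ z) 0) (ℤP.*-identityʳ (ℤ.+ n)) ⟨
  mkℚᵘ (ℤ.+ 1) 0 ℚᵘ.+ mkℚᵘ (ℤ.+ n) 0     ≈⟨ ℚᵘP.+-congʳ _ (toℚᵘ-ℕ→ℚ n) ⟨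
  toℚᵘ 1ℚ ℚᵘ.+ toℚᵘ (ℕ→ℚ n)              ≈⟨ QP.toℚᵘ-homo-+ 1ℚ (ℕ→ℚ n) ⟨
  toℚᵘ (1ℚ + ℕ→ℚ n)                      ∎)
  where open ℚᵘP.≃-Reasoning

ℕ→ℚ≡·1 : ∀ n → ℕ→ℚ n ≡ n · 1ℚ
ℕ→ℚ≡·1 zero    = refl
ℕ→ℚ≡·1 (suc n) = trans (ℕ→ℚ-suc n) (cong (1ℚ +_) (ℕ→ℚ≡·1 n))

ℕ→ℚ-* : ∀ m n → ℕ→ℚ (m ℕ.* n) ≡ ℕ→ℚ m * ℕ→ℚ n
ℕ→ℚ-* m n rewrite ℕ→ℚ≡·1 (m ℕ.* n) | ℕ→ℚ≡·1 m | ℕ→ℚ≡·1 n = ×1-homo-* m n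

ℕ→ℚ-*-/ : ∀ n q .{{_ : NonZero q}} → ℕ→ℚ q * (ℤ.+ n / q) ≡ ℕ→ℚ n
ℕ→ℚ-*-/ n q@(suc q-1) = QP.toℚᵘ-injective (begin
  toℚᵘ (ℕ→ℚ q * (ℤ.+ n / q))             ≈⟨ QP.toℚᵘ-homo-* (ℕ→ℚ q) (ℤ.+ n / q) ⟩
  toℚᵘ (ℕ→ℚ q) ℚᵘ.* toℚᵘ (ℤ.+ n / q)     ≈⟨ ℚᵘP.*-cong (toℚᵘ-ℕ→ℚ q) (QP.toℚᵘ-fromℚᵘ (mkℚᵘ (ℤ.+ n) q-1)) ⟩
  mkℚᵘ (ℤ.+ q) 0 ℚᵘ.* mkℚᵘ (ℤ.+ n) q-1   ≈⟨ ℚᵘ.*≡* cross-multiplied ⟩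
  mkℚᵘ (ℤ.+ n) 0                         ≈⟨ toℚᵘ-ℕ→ℚ n ⟨
  toℚᵘ (ℕ→ℚ n)                           ∎)
  where
  open ℚᵘP.≃-Reasoning
  cross-multiplied : (ℤ.+ q ℤ.* ℤ.+ n) ℤ.* ℤ.+ 1 ≡ ℤ.+ n ℤ.* ℤ.+ suc (q-1 ℕ.+ 0)
  cross-multiplied = trans (ℤP.*-identityʳ _) (trans (ℤP.*-comm (ℤ.+ q) (ℤ.+ n))
    (cong (λ m → ℤ.+ n ℤ.* ℤ.+ suc m) (sym (ℕP.+-identityʳ q-1))))

invℚ-unique : ∀ p {x} → p * x ≡ 1ℚ → invℚ p ≡ x
invℚ-unique p {x} p*x≡1 with p QP.≟ 0ℚ
... | yes refl = contradiction (trans (sym (QP.*-zeroˡ x)) p*x≡1) (QP.1≢0 ∘ sym)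
... | no p≢0 = begin
  1/p             ≡⟨ QP.*-identityʳ 1/p ⟨
  1/p * 1ℚ        ≡⟨ cong (1/p *_) p*x≡1 ⟨
  1/p * (p * x)   ≡⟨ QP.*-assoc 1/p p x ⟨
  (1/p * p) * x   ≡⟨ cong (_* x) (QP.*-inverseˡ p {{≢-nonZero p≢0}}) ⟩
  1ℚ * x          ≡⟨ QP.*-identityˡ x ⟩
  x               ∎
  where
  open ≡-Reasoning
  1/p = 1/_ p {{≢-nonZero p≢0}}

invℚ-* : ∀ p q → p * invℚ p ≡ 1ℚ → q * invℚ q ≡ 1ℚ → invℚ (p * q) ≡ invℚ p * invℚ q
invℚ-* p q p*p⁻¹≡1 q*q⁻¹≡1 = invℚ-unique (p * q) (begin
  (p * q) * (invℚ p * invℚ q)  ≡⟨ interchange p q (invℚ p) (invℚ q) ⟩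
  (p * invℚ p) * (q * invℚ q)  ≡⟨ cong₂ _*_ p*p⁻¹≡1 q*q⁻¹≡1 ⟩
  1ℚ                          ∎)
  where
  open ≡-Reasoning
  interchange : ∀ a b c d → (a * b) * (c * d) ≡ (a * c) * (b * d)
  interchange = solve-∀ ℚ-ring

ℕ→ℚ-*-invℚ : ∀ q .{{_ : NonZero q}} → ℕ→ℚ q * invℚ (ℕ→ℚ q) ≡ 1ℚ
ℕ→ℚ-*-invℚ q = subst (λ y → ℕ→ℚ q * y ≡ 1ℚ) (sym (invℚ-unique (ℕ→ℚ q) q*[1/q]≡1)) q*[1/q]≡1
  where
  q*[1/q]≡1 : ℕ→ℚ q * (ℤ.+ 1 / q) ≡ 1ℚ
  q*[1/q]≡1 = ℕ→ℚ-*-/ 1 q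

/-≡-*invℚ : ∀ n q .{{_ : NonZero q}} → ℤ.+ n / q ≡ ℕ→ℚ n * invℚ (ℕ→ℚ q)
/-≡-*invℚ n q = begin
  x                   ≡⟨ QP.*-identityʳ x ⟨
  x * 1ℚ              ≡⟨ cong (x *_) (ℕ→ℚ-*-invℚ q) ⟨
  x * (q' * q⁻¹)      ≡⟨ rearrange x q' q⁻¹ ⟩
  (q' * x) * q⁻¹      ≡⟨ cong (_* q⁻¹) (ℕ→ℚ-*-/ n q) ⟩
  ℕ→ℚ n * q⁻¹         ∎
  where
  open ≡-Reasoning
  x = ℤ.+ n / q
  q' = ℕ→ℚ q
  q⁻¹ = invℚ q'
  rearrange : ∀ a b c → a * (b * c) ≡ (b * a) * c
  rearrange = solve-∀ ℚ-ring

Σℚ≡sum : ∀ n (f : Fin n → ℚ) → Σℚ n f ≡ sum f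
Σℚ≡sum zero    f = refl
Σℚ≡sum (suc n) f = cong (f zero +_) (Σℚ≡sum n (f ∘ suc))

Σℚ-cong : ∀ n {f g : Fin n → ℚ} → (∀ i → f i ≡ g i) → Σℚ n f ≡ Σℚ n g
Σℚ-cong n {f} {g} f≗g = begin
  Σℚ n f  ≡⟨ Σℚ≡sum n f ⟩
  sum f   ≡⟨ sum-cong-≗ f≗g ⟩
  sum g   ≡⟨ Σℚ≡sum n g ⟨
  Σℚ n g  ∎
  where open ≡-Reasoning

Σℚ-+ : ∀ n (f g : Fin n → ℚ) → Σℚ n (λ i → f i + g i) ≡ Σℚ n f + Σℚ n g
Σℚ-+ n f g = begin
  Σℚ n (λ i → f i + g i)  ≡⟨ Σℚ≡sum n _ ⟩
  sum (λ i → f i + g i)   ≡⟨ ∑-distrib-+ f g ⟩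
  sum f + sum g           ≡⟨ cong₂ _+_ (Σℚ≡sum n f) (Σℚ≡sum n g) ⟨
  Σℚ n f + Σℚ n g         ∎
  where open ≡-Reasoning

Σℚ-*ˡ : ∀ n c (f : Fin n → ℚ) → Σℚ n (λ i → c * f i) ≡ c * Σℚ n f
Σℚ-*ˡ n c f = begin
  Σℚ n (λ i → c * f i)  ≡⟨ Σℚ≡sum n _ ⟩
  sum (λ i → c * f i)   ≡⟨ *-distribˡ-sum c f ⟨
  c * sum f             ≡⟨ cong (c *_) (Σℚ≡sum n f) ⟨
  c * Σℚ n f            ∎
  where open ≡-Reasoning

Σℚ-comm : ∀ m n (f : Fin m → Fin n → ℚ) →
          Σℚ m (λ i → Σℚ n (f i)) ≡ Σℚ n (λ j → Σℚ m (λ i → f i j))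
Σℚ-comm m n f = begin
  Σℚ m (λ i → Σℚ n (f i))             ≡⟨ Σℚ≡sum m _ ⟩
  sum (λ i → Σℚ n (f i))              ≡⟨ sum-cong-≗ (λ i → Σℚ≡sum n (f i)) ⟩
  sum (λ i → sum (f i))               ≡⟨ ∑-comm f ⟩
  sum (λ j → sum (λ i → f i j))       ≡⟨ sum-cong-≗ (λ j → Σℚ≡sum m (λ i → f i j)) ⟨
  sum (λ j → Σℚ m (λ i → f i j))      ≡⟨ Σℚ≡sum n _ ⟨
  Σℚ n (λ j → Σℚ m (λ i → f i j))     ∎
  where open ≡-Reasoning

Σℚ-const : ∀ n c → Σℚ n (λ _ → c) ≡ ℕ→ℚ n * c
Σℚ-const n c = begin
  Σℚ n (λ _ → c)     ≡⟨ Σℚ≡sum n (λ _ → c) ⟩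
  sum {n} (λ _ → c)  ≡⟨ sum-replicate n {c} ⟩
  n · c              ≡⟨ cong (n ·_) (QP.*-identityˡ c) ⟨
  n · (1ℚ * c)       ≡⟨ ×-assoc-* n 1ℚ c ⟨
  (n · 1ℚ) * c       ≡⟨ cong (_* c) (ℕ→ℚ≡·1 n) ⟨
  ℕ→ℚ n * c          ∎
  where open ≡-Reasoning

δ-refl : ∀ {n} (i : Fin n) → δ i i ≡ 1ℚ
δ-refl i with i ≟ i
... | yes _   = refl
... | no  i≢i = contradiction refl i≢i

δ-sym : ∀ {n} (i j : Fin n) → δ i j ≡ δ j i
δ-sym i j with i ≟ j | j ≟ i
... | yes _   | yes _   = refl
... | no  _   | no  _   = refl
... | yes i≡j | no  j≢i = contradiction (sym i≡j) j≢i
... | no  i≢j | yes j≡i = contradiction (sym j≡i) i≢j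

δ-suc : ∀ {n} (i j : Fin n) → δ (suc i) (suc j) ≡ δ i j
δ-suc i j with i ≟ j
... | yes _ = refl
... | no  _ = refl

Σℚ-δ : ∀ {n} (i : Fin n) (f : Fin n → ℚ) → Σℚ n (λ j → δ i j * f j) ≡ f i
Σℚ-δ {suc n} zero f = begin
  1ℚ * f zero + Σℚ n (λ j → 0ℚ * f (suc j))  ≡⟨ cong (1ℚ * f zero +_) (Σℚ-*ˡ n 0ℚ (f ∘ suc)) ⟩
  1ℚ * f zero + 0ℚ * Σℚ n (f ∘ suc)          ≡⟨ cong₂ _+_ (QP.*-identityˡ (f zero)) (QP.*-zeroˡ (Σℚ n (f ∘ suc))) ⟩
  f zero + 0ℚ                                ≡⟨ QP.+-identityʳ (f zero) ⟩
  f zero                                     ∎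
  where open ≡-Reasoning
Σℚ-δ {suc n} (suc i) f = begin
  0ℚ * f zero + Σℚ n (λ j → δ (suc i) (suc j) * f (suc j))
    ≡⟨ cong₂ _+_ (QP.*-zeroˡ (f zero)) (Σℚ-cong n (λ j → cong (_* f (suc j)) (δ-suc i j))) ⟩
  0ℚ + Σℚ n (λ j → δ i j * f (suc j))  ≡⟨ QP.+-identityˡ _ ⟩
  Σℚ n (λ j → δ i j * f (suc j))       ≡⟨ Σℚ-δ i (f ∘ suc) ⟩
  f (suc i)                            ∎
  where open ≡-Reasoning

Σℚ-nonNeg : ∀ n (f : Fin n → ℚ) → (∀ i → 0ℚ ≤ f i) → 0ℚ ≤ Σℚ n f
Σℚ-nonNeg zero    f f≥0 = QP.≤-refl
Σℚ-nonNeg (suc n) f f≥0 = QP.+-mono-≤ (f≥0 zero) (Σℚ-nonNeg n (f ∘ suc) (f≥0 ∘ suc))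

Σℚ-≥-term : ∀ {n} (f : Fin n → ℚ) → (∀ i → 0ℚ ≤ f i) → ∀ i → f i ≤ Σℚ n f
Σℚ-≥-term {suc n} f f≥0 zero = begin
  f zero                   ≡⟨ QP.+-identityʳ (f zero) ⟨
  f zero + 0ℚ              ≤⟨ QP.+-monoʳ-≤ (f zero) (Σℚ-nonNeg n (f ∘ suc) (f≥0 ∘ suc)) ⟩
  f zero + Σℚ n (f ∘ suc)  ∎
  where open QP.≤-Reasoning
Σℚ-≥-term {suc n} f f≥0 (suc i) = begin
  f (suc i)                ≡⟨ QP.+-identityˡ (f (suc i)) ⟨
  0ℚ + f (suc i)           ≤⟨ QP.+-mono-≤ (f≥0 zero) (Σℚ-≥-term (f ∘ suc) (f≥0 ∘ suc) i) ⟩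
  f zero + Σℚ n (f ∘ suc)  ∎
  where open QP.≤-Reasoning

δ*δ-nonNeg : ∀ {n m} (i j : Fin n) (k l : Fin m) → 0ℚ ≤ δ i j * δ k l
δ*δ-nonNeg i j k l with i ≟ j | k ≟ l
... | yes _ | yes _ = QP.nonNegative⁻¹ _
... | yes _ | no  _ = QP.nonNegative⁻¹ _
... | no  _ | yes _ = QP.nonNegative⁻¹ _
... | no  _ | no  _ = QP.nonNegative⁻¹ _

-- MapMatrices.N and MapMatrices.M are Inc vert and Inc face, definitionally.
Inc : ∀ {n m} → (Fin n → Fin m) → Mat n m
Inc h a w = δ (h a) w

Inc⊗diagInv⊗Incᵀ : ∀ {n m} (h : Fin n → Fin m) (E : Mat m m) (a b : Fin n) →
                   (Inc h ⊗ diagInv E ⊗ Inc h ᵀ) a b ≡ invℚ (E (h a) (h a)) * δ (h b) (h a)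
Inc⊗diagInv⊗Incᵀ {m = m} h E a b = begin
  Σℚ m (λ g → Σℚ m (λ f → δ (h a) f * (δ f g * invℚ (E f f))) * δ (h b) g)
    ≡⟨ Σℚ-cong m (λ g → cong (_* δ (h b) g) (Σℚ-δ (h a) (λ f → δ f g * invℚ (E f f)))) ⟩
  Σℚ m (λ g → (δ (h a) g * e⁻¹) * δ (h b) g)  ≡⟨ Σℚ-cong m (λ g → QP.*-assoc (δ (h a) g) e⁻¹ (δ (h b) g)) ⟩
  Σℚ m (λ g → δ (h a) g * (e⁻¹ * δ (h b) g))  ≡⟨ Σℚ-δ (h a) (λ g → e⁻¹ * δ (h b) g) ⟩
  e⁻¹ * δ (h b) (h a)                         ∎
  where
  open ≡-Reasoning
  e⁻¹ = invℚ (E (h a) (h a))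

tr-Incᵀ⊗Inc : ∀ {n m} (h : Fin n → Fin m) → tr (Inc h ᵀ ⊗ Inc h) ≡ ℕ→ℚ n
tr-Incᵀ⊗Inc {n} {m} h = begin
  Σℚ m (λ w → Σℚ n (λ a → δ (h a) w * δ (h a) w))  ≡⟨ Σℚ-comm m n (λ w a → δ (h a) w * δ (h a) w) ⟩
  Σℚ n (λ a → Σℚ m (λ w → δ (h a) w * δ (h a) w))  ≡⟨ Σℚ-cong n (λ a → Σℚ-δ (h a) (δ (h a))) ⟩
  Σℚ n (λ a → δ (h a) (h a))                       ≡⟨ Σℚ-cong n (δ-refl ∘ h) ⟩
  Σℚ n (λ _ → 1ℚ)                                  ≡⟨ Σℚ-const n 1ℚ ⟩
  ℕ→ℚ n * 1ℚ                                       ≡⟨ QP.*-identityʳ (ℕ→ℚ n) ⟩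
  ℕ→ℚ n                                            ∎
  where open ≡-Reasoning

Incᵀ⊗Inc-≢0 : ∀ {n m l} (h : Fin n → Fin m) (g : Fin n → Fin l) (a : Fin n) →
              (Inc h ᵀ ⊗ Inc g) (h a) (g a) ≢ 0ℚ
Incᵀ⊗Inc-≢0 {n} h g a = QP.<⇒≢ 0<Σ ∘ sym
  where
  term : Fin n → ℚ
  term b = δ (h b) (h a) * δ (g b) (g a)
  0<Σ : 0ℚ < Σℚ n term
  0<Σ = QP.<-≤-trans (QP.positive⁻¹ 1ℚ) (begin
    1ℚ          ≡⟨ cong₂ _*_ (δ-refl (h a)) (δ-refl (g a)) ⟨
    term a      ≤⟨ Σℚ-≥-term term (λ b → δ*δ-nonNeg (h b) (h a) (g b) (g a)) a ⟩
    Σℚ n term   ∎)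
    where open QP.≤-Reasoning

[2P-I]⊗[2Q-I]-diag : ∀ {n} (P Q : Mat n n) (a : Fin n) →
  ((scale 2ℚ P ⊖ I) ⊗ (scale 2ℚ Q ⊖ I)) a a ≡ (2ℚ * 2ℚ) * (P ⊗ Q) a a + (1ℚ - 2ℚ * Q a a - 2ℚ * P a a)
[2P-I]⊗[2Q-I]-diag {n} P Q a = begin
  Σℚ n (λ b → (2ℚ * P a b - δ a b) * (2ℚ * Q b a - δ b a))
    ≡⟨ Σℚ-cong n (λ b → cong (λ e → (2ℚ * P a b - δ a b) * (2ℚ * Q b a - e)) (δ-sym b a)) ⟩
  Σℚ n (λ b → (2ℚ * P a b - δ a b) * (2ℚ * Q b a - δ a b))
    ≡⟨ Σℚ-cong n (λ b → expand 2ℚ (P a b) (Q b a) (δ a b)) ⟩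
  Σℚ n (λ b → (2ℚ * 2ℚ) * (P a b * Q b a) + δ a b * (δ a b - 2ℚ * Q b a - 2ℚ * P a b))
    ≡⟨ Σℚ-+ n _ _ ⟩
  Σℚ n (λ b → (2ℚ * 2ℚ) * (P a b * Q b a)) + Σℚ n (λ b → δ a b * (δ a b - 2ℚ * Q b a - 2ℚ * P a b))
    ≡⟨ cong₂ _+_ (Σℚ-*ˡ n (2ℚ * 2ℚ) _) (Σℚ-δ a (λ b → δ a b - 2ℚ * Q b a - 2ℚ * P a b)) ⟩
  (2ℚ * 2ℚ) * (P ⊗ Q) a a + (δ a a - 2ℚ * Q a a - 2ℚ * P a a)
    ≡⟨ cong (λ e → (2ℚ * 2ℚ) * (P ⊗ Q) a a + (e - 2ℚ * Q a a - 2ℚ * P a a)) (δ-refl a) ⟩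
  (2ℚ * 2ℚ) * (P ⊗ Q) a a + (1ℚ - 2ℚ * Q a a - 2ℚ * P a a) ∎
  where
  open ≡-Reasoning
  expand : ∀ t p q e → (t * p - e) * (t * q - e) ≡ (t * t) * (p * q) + e * (e - t * q - t * p)
  expand = solve-∀ ℚ-ring

diagU : (k⁻¹ d⁻¹ m : ℚ) → ℚ
diagU k⁻¹ d⁻¹ m = (2ℚ * 2ℚ) * ((k⁻¹ * d⁻¹) * m) + (1ℚ - 2ℚ * d⁻¹ - 2ℚ * k⁻¹)

module RegularMap (X : OrientableMap) (k d : ℕ) (type : IsOfType X k d) where
  open OrientableMap X
  open MapMatrices X

  k⁻¹ d⁻¹ : ℚ
  k⁻¹ = invℚ (ℕ→ℚ k)
  d⁻¹ = invℚ (ℕ→ℚ d)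

  P-entry : ∀ a b → P a b ≡ k⁻¹ * δ (face b) (face a)
  P-entry a b = trans (Inc⊗diagInv⊗Incᵀ face Δ a b)
                      (cong (λ e → invℚ e * δ (face b) (face a)) (proj₂ type (face a)))

  Q-entry : ∀ a b → Q a b ≡ d⁻¹ * δ (vert b) (vert a)
  Q-entry a b = trans (Inc⊗diagInv⊗Incᵀ vert D a b)
                      (cong (λ e → invℚ e * δ (vert b) (vert a)) (proj₁ type (vert a)))

  P-diag : ∀ a → P a a ≡ k⁻¹
  P-diag a = trans (P-entry a a) (trans (cong (k⁻¹ *_) (δ-refl (face a))) (QP.*-identityʳ k⁻¹))

  Q-diag : ∀ a → Q a a ≡ d⁻¹
  Q-diag a = trans (Q-entry a a) (trans (cong (d⁻¹ *_) (δ-refl (vert a))) (QP.*-identityʳ d⁻¹))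

  P⊗Q-diag : ∀ a → (P ⊗ Q) a a ≡ (k⁻¹ * d⁻¹) * NᵀM (vert a) (face a)
  P⊗Q-diag a = begin
    Σℚ nA (λ b → P a b * Q b a)
      ≡⟨ Σℚ-cong nA (λ b → cong₂ _*_ (P-entry a b) (trans (Q-entry b a) (cong (d⁻¹ *_) (δ-sym (vert a) (vert b))))) ⟩
    Σℚ nA (λ b → (k⁻¹ * δ (face b) (face a)) * (d⁻¹ * δ (vert b) (vert a)))
      ≡⟨ Σℚ-cong nA (λ b → rearrange k⁻¹ (δ (face b) (face a)) d⁻¹ (δ (vert b) (vert a))) ⟩
    Σℚ nA (λ b → (k⁻¹ * d⁻¹) * (δ (vert b) (vert a) * δ (face b) (face a)))
      ≡⟨ Σℚ-*ˡ nA (k⁻¹ * d⁻¹) _ ⟩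
    (k⁻¹ * d⁻¹) * NᵀM (vert a) (face a)
      ∎
    where
    open ≡-Reasoning
    rearrange : ∀ x e y f → (x * e) * (y * f) ≡ (x * y) * (f * e)
    rearrange = solve-∀ ℚ-ring

  U-diag : ∀ a → U a a ≡ diagU k⁻¹ d⁻¹ (NᵀM (vert a) (face a))
  U-diag a = trans ([2P-I]⊗[2Q-I]-diag P Q a)
    (cong₂ _+_ (cong ((2ℚ * 2ℚ) *_) (P⊗Q-diag a))
               (cong₂ (λ q p → 1ℚ - 2ℚ * q - 2ℚ * p) (Q-diag a) (P-diag a)))

  nA≡nV*d : ℕ→ℚ nA ≡ ℕ→ℚ nV * ℕ→ℚ d
  nA≡nV*d = begin
    ℕ→ℚ nA               ≡⟨ tr-Incᵀ⊗Inc vert ⟨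
    tr D                 ≡⟨ Σℚ-cong nV (proj₁ type) ⟩
    Σℚ nV (λ _ → ℕ→ℚ d)  ≡⟨ Σℚ-const nV (ℕ→ℚ d) ⟩
    ℕ→ℚ nV * ℕ→ℚ d       ∎
    where open ≡-Reasoning

  nA≡nF*k : ℕ→ℚ nA ≡ ℕ→ℚ nF * ℕ→ℚ k
  nA≡nF*k = begin
    ℕ→ℚ nA               ≡⟨ tr-Incᵀ⊗Inc face ⟨
    tr Δ                 ≡⟨ Σℚ-cong nF (proj₂ type) ⟩
    Σℚ nF (λ _ → ℕ→ℚ k)  ≡⟨ Σℚ-const nF (ℕ→ℚ k) ⟩
    ℕ→ℚ nF * ℕ→ℚ k       ∎
    where open ≡-Reasoning

diagU-formula : ∀ k d α .{{_ : NonZero k}} .{{_ : NonZero d}} →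
  diagU (invℚ (ℕ→ℚ k)) (invℚ (ℕ→ℚ d)) (ℕ→ℚ α)
    ≡ ((((ℤ.+ (4 ℕ.* α)) / (k ℕ.* d)) {{m*n≢0 k d}} - (ℤ.+ 2) / k) - (ℤ.+ 2) / d) + 1ℚ
diagU-formula k d α = sym (begin
  (((ℤ.+ (4 ℕ.* α)) / (k ℕ.* d)) {{m*n≢0 k d}} - (ℤ.+ 2) / k) - (ℤ.+ 2) / d + 1ℚ
    ≡⟨ cong (_+ 1ℚ) (cong₂ _-_ (cong₂ _-_ 4α/kd (/-≡-*invℚ 2 k)) (/-≡-*invℚ 2 d)) ⟩
  ((2ℚ * 2ℚ) * α') * (k⁻¹ * d⁻¹) - 2ℚ * k⁻¹ - 2ℚ * d⁻¹ + 1ℚ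
    ≡⟨ regroup 2ℚ α' k⁻¹ d⁻¹ ⟩
  diagU k⁻¹ d⁻¹ α'
    ∎)
  where
  open ≡-Reasoning
  k⁻¹ = invℚ (ℕ→ℚ k)
  d⁻¹ = invℚ (ℕ→ℚ d)
  α' = ℕ→ℚ α
  4α/kd : ((ℤ.+ (4 ℕ.* α)) / (k ℕ.* d)) {{m*n≢0 k d}} ≡ ((2ℚ * 2ℚ) * α') * (k⁻¹ * d⁻¹)
  4α/kd = trans (/-≡-*invℚ (4 ℕ.* α) (k ℕ.* d) {{m*n≢0 k d}})
    (cong₂ _*_ (ℕ→ℚ-* 4 α)
               (trans (cong invℚ (ℕ→ℚ-* k d)) (invℚ-* (ℕ→ℚ k) (ℕ→ℚ d) (ℕ→ℚ-*-invℚ k) (ℕ→ℚ-*-invℚ d))))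
  regroup : ∀ t a x y → (t * t) * a * (x * y) - t * x - t * y + 1ℚ ≡ (t * t) * ((x * y) * a) + (1ℚ - t * y - t * x)
  regroup = solve-∀ ℚ-ring

trace-formula : ∀ k d α nA nV nF .{{_ : NonZero k}} .{{_ : NonZero d}} →
  ℕ→ℚ nA ≡ ℕ→ℚ nV * ℕ→ℚ d → ℕ→ℚ nA ≡ ℕ→ℚ nF * ℕ→ℚ k →
  ℕ→ℚ nA * diagU (invℚ (ℕ→ℚ k)) (invℚ (ℕ→ℚ d)) (ℕ→ℚ α)
    ≡ (((ℤ.+ (4 ℕ.* α ℕ.* nV)) / k - ℕ→ℚ (2 ℕ.* nF)) - ℕ→ℚ (2 ℕ.* nV)) + ℕ→ℚ nA
trace-formula k d α nA nV nF nA≡nV*d nA≡nF*k = begin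
  A * diagU k⁻¹ d⁻¹ α'
    ≡⟨ distribute 2ℚ A α' k⁻¹ d⁻¹ ⟩
  ((2ℚ * 2ℚ) * α' * (A * d⁻¹)) * k⁻¹ - 2ℚ * (A * k⁻¹) - 2ℚ * (A * d⁻¹) + A
    ≡⟨ cong₂ (λ v f → ((2ℚ * 2ℚ) * α' * v) * k⁻¹ - 2ℚ * f - 2ℚ * v + A)
         (divide-out V (ℕ→ℚ d) nA≡nV*d (ℕ→ℚ-*-invℚ d)) (divide-out F (ℕ→ℚ k) nA≡nF*k (ℕ→ℚ-*-invℚ k)) ⟩
  ((2ℚ * 2ℚ) * α' * V) * k⁻¹ - 2ℚ * F - 2ℚ * V + A
    ≡⟨ cong (_+ A) (cong₂ _-_ (cong₂ _-_ 4αV/k (ℕ→ℚ-* 2 nF)) (ℕ→ℚ-* 2 nV)) ⟨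
  (ℤ.+ (4 ℕ.* α ℕ.* nV)) / k - ℕ→ℚ (2 ℕ.* nF) - ℕ→ℚ (2 ℕ.* nV) + A
    ∎
  where
  open ≡-Reasoning
  k⁻¹ = invℚ (ℕ→ℚ k)
  d⁻¹ = invℚ (ℕ→ℚ d)
  α' = ℕ→ℚ α
  A = ℕ→ℚ nA
  V = ℕ→ℚ nV
  F = ℕ→ℚ nF
  distribute : ∀ t a α x y → a * ((t * t) * ((x * y) * α) + (1ℚ - t * y - t * x))
                             ≡ ((t * t) * α * (a * y)) * x - t * (a * x) - t * (a * y) + a
  distribute = solve-∀ ℚ-ring
  divide-out : ∀ {x} y q → x ≡ y * q → q * invℚ q ≡ 1ℚ → x * invℚ q ≡ y
  divide-out {x} y q x≡y*q q*q⁻¹≡1 = begin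
    x * invℚ q        ≡⟨ cong (_* invℚ q) x≡y*q ⟩
    y * q * invℚ q    ≡⟨ QP.*-assoc y q (invℚ q) ⟩
    y * (q * invℚ q)  ≡⟨ cong (y *_) q*q⁻¹≡1 ⟩
    y * 1ℚ            ≡⟨ QP.*-identityʳ y ⟩
    y                 ∎
  4αV/k : (ℤ.+ (4 ℕ.* α ℕ.* nV)) / k ≡ ((2ℚ * 2ℚ) * α' * V) * k⁻¹
  4αV/k = trans (/-≡-*invℚ (4 ℕ.* α ℕ.* nV) k)
                (cong (_* k⁻¹) (trans (ℕ→ℚ-* (4 ℕ.* α) nV) (cong (_* V) (ℕ→ℚ-* 4 α))))

lemma3p4 : (X : OrientableMap) (k d α : ℕ) .{{_ : NonZero k}} .{{_ : NonZero d}} →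
    IsOfType X k d → HasIncidenceMultiplicity X α →
    let open OrientableMap X
        open MapMatrices X
    in (∀ a → U a a ≡ ((((ℤ.+ (4 ℕ.* α)) / (k ℕ.* d)) {{m*n≢0 k d}} - (ℤ.+ 2) / k) - (ℤ.+ 2) / d) + 1ℚ)
       × (tr U ≡ (((ℤ.+ (4 ℕ.* α ℕ.* nV)) / k - ℕ→ℚ (2 ℕ.* nF)) - ℕ→ℚ (2 ℕ.* nV)) + ℕ→ℚ nA)
lemma3p4 X k d α type multiplicity =
  (λ a → trans (U-diag-α a) (diagU-formula k d α)) ,
  (begin
    Σℚ nA (λ a → U a a)                   ≡⟨ Σℚ-cong nA U-diag-α ⟩
    Σℚ nA (λ _ → diagU k⁻¹ d⁻¹ (ℕ→ℚ α))   ≡⟨ Σℚ-const nA _ ⟩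
    ℕ→ℚ nA * diagU k⁻¹ d⁻¹ (ℕ→ℚ α)        ≡⟨ trace-formula k d α nA nV nF nA≡nV*d nA≡nF*k ⟩
    (((ℤ.+ (4 ℕ.* α ℕ.* nV)) / k - ℕ→ℚ (2 ℕ.* nF)) - ℕ→ℚ (2 ℕ.* nV)) + ℕ→ℚ nA ∎)
  where
  open OrientableMap X
  open MapMatrices X
  open RegularMap X k d type
  open ≡-Reasoning

  U-diag-α : ∀ a → U a a ≡ diagU k⁻¹ d⁻¹ (ℕ→ℚ α)
  U-diag-α a = trans (U-diag a)
    (cong (diagU k⁻¹ d⁻¹) (multiplicity (vert a) (face a) (Incᵀ⊗Inc-≢0 vert face a)))
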